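{- Let $\Omega$ be a finite set and let $1\leq k\leq|\Omega|$. Then: (1) $\mathcal{U}_{k,\Omega}$ is a graph-immune clutter (i.e. there is a graph $G$ with $V(G)=\Omega$ whose family of inclusion-minimal immune sets equals $\mathcal{U}_{k,\Omega}$) if and only if $k=1$ or $k=2$; (2) $\mathcal{U}_{k,\Omega}$ is a graph-forcing clutter (i.e. there is a graph $G$ with $V(G)=\Omega$ whose family of inclusion-minimal forcing sets equals $\mathcal{U}_{k,\Omega}$) if and only if $k=|\Omega|-1$ or $k=|\Omega|$.
   Context: For a finite set $\Omega$, $\mathcal{U}_{k,\Omega}=\{A\subseteq\Omega: |A|=k\}$. Graphs are simple and undirected. Zero forcing rule on a graph $G$: vertices are black or white; at each step a black vertex with exactly one white neighbour forces this neighbour to become black; iterating until no change is possible from an initial black set $B$ gives a final black set $\mathcal{R}^\ast(B)$ independent of the order of steps. A forcing set is a non-empty $F\subseteq V(G)$ with $\mathcal{R}^\ast(F)=V(G)$; an immune set is a non-empty $I\subseteq V(G)$ with $\mathcal{R}^\ast(V(G)\setminus I)=V(G)\setminus I$. -}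

module Defs where

open import Data.Nat using (ℕ)
open import Data.Bool using (Bool; true; false)
open import Data.Fin using (Fin)
open import Data.Fin.Subset using (Subset; _∈_; _∉_; _⊆_; ∁; ∣_∣; Nonempty)
open import Relation.Binary.PropositionalEquality using (_≡_; _≢_)
open import Data.Product using (Σ; ∃; _×_)
open import Function.Bundles using (_⇔_)

-- A finite simple undirected graph on the vertex set Fin n
-- (the finite set Ω is identified with Fin |Ω|).
record Graph (n : ℕ) : Set where
  field
    adj   : Fin n → Fin n → Bool
    sym   : ∀ i j → adj i j ≡ adj j i
    irrefl : ∀ i → adj i i ≡ false

open Graph public

Adj : ∀ {n} → Graph n → Fin n → Fin n → Set
Adj G i j = adj G i j ≡ true

-- Black B G w : w is black in the final black set R*(B), i.e. w is in B or
-- becomes black by a sequence of forcing steps: a black vertex v forces its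
-- neighbour w when all other neighbours of v are black.
data Black {n : ℕ} (G : Graph n) (B : Subset n) : Fin n → Set where
  initial : ∀ {w} → w ∈ B → Black G B w
  force   : ∀ {v w} → Black G B v → Adj G v w →
            (∀ u → Adj G v u → u ≢ w → Black G B u) → Black G B w

IsForcing : ∀ {n} → Graph n → Subset n → Set
IsForcing G F = Nonempty F × (∀ v → Black G F v)

-- Immune set: non-empty I with R*(V(G) \ I) = V(G) \ I.
IsImmune : ∀ {n} → Graph n → Subset n → Set
IsImmune G I = Nonempty I × (∀ v → Black G (∁ I) v → v ∉ I)

Minimal : ∀ {n} → (Subset n → Set) → Subset n → Set
Minimal P A = P A × (∀ B → B ⊆ A → P B → A ⊆ B)

EqualsUniform : ∀ {n} → (Subset n → Set) → ℕ → Set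
EqualsUniform {n} P k = ∀ (A : Subset n) → Minimal P A ⇔ (∣ A ∣ ≡ k)

GraphImmuneUniform : ℕ → ℕ → Set
GraphImmuneUniform n k = Σ (Graph n) λ G → EqualsUniform (IsImmune G) k

GraphForcingUniform : ℕ → ℕ → Set
GraphForcingUniform n k = Σ (Graph n) λ G → EqualsUniform (IsForcing G) k

{-# OPTIONS --safe #-}
-- Immune sets are exactly the nonempty forts: sets B such that no vertex outside B has exactly
-- one neighbour in B; and a forcing set meets every nonempty fort. The empty graph realises
-- k = 1 (immune) and k = n (forcing), the complete graph k = 2 (immune) and k = n ∸ 1 (forcing).
-- Conversely, an immune clutter with k ≥ 3, or a forcing clutter with k ≤ n ∸ 2, yields a
-- threshold m ≥ 2 (m = k ∸ 1, resp. m = n ∸ k) such that every (m + 1)-set is a fort while no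
-- nonempty set of at most m vertices is. In such a graph every vertex x has a neighbour y adjacent
-- to none of the non-neighbours of x (else these and x form a small fort), and x, y are not twins
-- (else {x, y} is a small fort); hence the non-neighbours of x are a proper subset of those of y.
-- The number of non-neighbours thus increases without bound, so the graph has no vertex.
module Submission where

open import Defs hiding (sym)
open import Data.Bool using (true; false; not; _∧_)
import Data.Bool as Bool
open import Data.Empty using (⊥-elim)
open import Data.Fin using (Fin; zero; suc; _≟_; fromℕ<)
open import Data.Fin.Properties using (any?)
open import Data.Fin.Subset
open import Data.Fin.Subset.Properties
open import Data.Nat using (ℕ; zero; suc; pred; _+_; _≤_; _<_; _∸_; s≤s; z≤n)
open import Data.Nat.Properties hiding (_≟_)
open import Data.Product using (∃-syntax; _×_; _,_; proj₁; proj₂)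
open import Data.Sum using (_⊎_; inj₁; inj₂)
open import Data.Vec using ([]; _∷_; here; there; tabulate)
open import Data.Vec.Properties using (lookup∘tabulate; lookup⇒[]=; []=⇒lookup)
open import Function.Base using (_∘_)
open import Function.Bundles using (_⇔_; mk⇔; Equivalence)
open import Relation.Nullary using (¬_; Dec; yes; no; does; contradiction; ¬?; _×-dec_)
open import Relation.Binary.PropositionalEquality

open Equivalence using (to; from)

private
  variable
    n : ℕ
    x y a : Fin n
    p q : Subset n

x∈p⇒⁅x⁆⊆p : x ∈ p → ⁅ x ⁆ ⊆ p
x∈p⇒⁅x⁆⊆p {x = x} x∈p y∈⁅x⁆ = subst (_∈ _) (sym (x∈⁅y⁆⇒x≡y x y∈⁅x⁆)) x∈p

Nonempty⇒1≤∣p∣ : Nonempty p → 1 ≤ ∣ p ∣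
Nonempty⇒1≤∣p∣ (x , x∈p) = subst (_≤ _) (∣⁅x⁆∣≡1 x) (p⊆q⇒∣p∣≤∣q∣ (x∈p⇒⁅x⁆⊆p x∈p))

1≤∣p∣⇒Nonempty : 1 ≤ ∣ p ∣ → Nonempty p
1≤∣p∣⇒Nonempty {n} {p} 1≤∣p∣ with nonempty? p
... | yes nonempty = nonempty
... | no empty = contradiction (trans (cong ∣_∣ (Empty-unique empty)) (∣⊥∣≡0 n)) (≢-sym (<⇒≢ 1≤∣p∣))

p⊆q∧∣q∣≤∣p∣⇒q⊆p : p ⊆ q → ∣ q ∣ ≤ ∣ p ∣ → q ⊆ p
p⊆q∧∣q∣≤∣p∣⇒q⊆p {p = p} p⊆q ∣q∣≤∣p∣ {x} x∈q with x ∈? p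
... | yes x∈p = x∈p
... | no x∉p = contradiction ∣q∣≤∣p∣ (<⇒≱ (p⊂q⇒∣p∣<∣q∣ (p⊆q , x , x∈q , x∉p)))

∣p∪⁅x⁆∣≡1+∣p∣ : x ∉ p → ∣ p ∪ ⁅ x ⁆ ∣ ≡ suc ∣ p ∣
∣p∪⁅x⁆∣≡1+∣p∣ {x = zero}  {outside ∷ p} _   = cong (λ q → suc ∣ q ∣) (∪-identityʳ p)
∣p∪⁅x⁆∣≡1+∣p∣ {x = zero}  {inside ∷ p}  x∉p = contradiction here x∉p
∣p∪⁅x⁆∣≡1+∣p∣ {x = suc x} {outside ∷ p} x∉p = ∣p∪⁅x⁆∣≡1+∣p∣ (x∉p ∘ there)
∣p∪⁅x⁆∣≡1+∣p∣ {x = suc x} {inside ∷ p}  x∉p = cong suc (∣p∪⁅x⁆∣≡1+∣p∣ (x∉p ∘ there))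

x∈p∧y∈p∧x≢y⇒2≤∣p∣ : x ∈ p → y ∈ p → x ≢ y → 2 ≤ ∣ p ∣
x∈p∧y∈p∧x≢y⇒2≤∣p∣ {x = x} {p} {y} x∈p y∈p x≢y = begin
  2                     ≡⟨ cong suc (sym (∣⁅x⁆∣≡1 x)) ⟩
  suc ∣ ⁅ x ⁆ ∣         ≡⟨ sym (∣p∪⁅x⁆∣≡1+∣p∣ (x≢y⇒x∉⁅y⁆ (x≢y ∘ sym))) ⟩
  ∣ ⁅ x ⁆ ∪ ⁅ y ⁆ ∣     ≤⟨ p⊆q⇒∣p∣≤∣q∣ pair⊆p ⟩
  ∣ p ∣                 ∎
  where
  open ≤-Reasoning
  pair⊆p : ⁅ x ⁆ ∪ ⁅ y ⁆ ⊆ p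
  pair⊆p z∈ with x∈p∪q⁻ ⁅ x ⁆ ⁅ y ⁆ z∈
  ... | inj₁ z∈⁅x⁆ = x∈p⇒⁅x⁆⊆p x∈p z∈⁅x⁆
  ... | inj₂ z∈⁅y⁆ = x∈p⇒⁅x⁆⊆p y∈p z∈⁅y⁆

2≤∣p∣⇒∃≢ : 2 ≤ ∣ p ∣ → ∀ x → ∃[ y ] y ∈ p × y ≢ x
2≤∣p∣⇒∃≢ {p = p} 2≤∣p∣ x with any? (λ y → y ∈? p ×-dec ¬? (y ≟ x))
... | yes found = found
... | no none = contradiction 2≤∣p∣ (<⇒≱ (s≤s (≤-trans (p⊆q⇒∣p∣≤∣q∣ p⊆⁅x⁆) (≤-reflexive (∣⁅x⁆∣≡1 x)))))
  where
  p⊆⁅x⁆ : p ⊆ ⁅ x ⁆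
  p⊆⁅x⁆ {y} y∈p with y ≟ x
  ... | yes refl = x∈⁅x⁆ x
  ... | no y≢x = contradiction (y , y∈p , y≢x) none

subset-of-size : ∀ (p : Subset n) {j} → j ≤ ∣ p ∣ → ∃[ q ] q ⊆ p × ∣ q ∣ ≡ j
subset-of-size []            {zero}  _ = [] , (λ x∈[] → x∈[]) , refl
subset-of-size (outside ∷ p)         j≤∣p∣ with subset-of-size p j≤∣p∣
... | q , q⊆p , ∣q∣≡j = outside ∷ q , out⊆ q⊆p , ∣q∣≡j
subset-of-size {suc n} (inside ∷ p) {zero} _ = ⊥ , ⊥⊆ , ∣⊥∣≡0 (suc n)
subset-of-size (inside ∷ p)  {suc j} (s≤s j≤∣p∣) with subset-of-size p j≤∣p∣
... | q , q⊆p , ∣q∣≡j = inside ∷ q , s⊆s q⊆p , cong suc ∣q∣≡j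

superset-of-size : ∀ (p : Subset n) {j} → ∣ p ∣ ≤ j → j ≤ n → ∃[ q ] p ⊆ q × ∣ q ∣ ≡ j
superset-of-size {n} p {j} ∣p∣≤j j≤n with subset-of-size (∁ p) n∸j≤∣∁p∣
  where
  n∸j≤∣∁p∣ : n ∸ j ≤ ∣ ∁ p ∣
  n∸j≤∣∁p∣ = subst (n ∸ j ≤_) (sym (∣∁p∣≡n∸∣p∣ p)) (∸-monoʳ-≤ n ∣p∣≤j)
... | s , s⊆∁p , ∣s∣≡n∸j = ∁ s , p⊆∁s , ∣∁s∣≡j
  where
  p⊆∁s : p ⊆ ∁ s
  p⊆∁s x∈p = x∉p⇒x∈∁p (λ x∈s → x∈∁p⇒x∉p (s⊆∁p x∈s) x∈p)
  ∣∁s∣≡j : ∣ ∁ s ∣ ≡ j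
  ∣∁s∣≡j = trans (∣∁p∣≡n∸∣p∣ s) (trans (cong (n ∸_) ∣s∣≡n∸j) (m∸[m∸n]≡n j≤n))

threshold⇒uniform : ∀ {P : Subset n → Set} k → (∀ A → P A ⇔ k ≤ ∣ A ∣) → EqualsUniform P k
threshold⇒uniform {P = P} k P⇔ A = mk⇔ minimal⇒size size⇒minimal
  where
  minimal⇒size : Minimal P A → ∣ A ∣ ≡ k
  minimal⇒size (PA , minimal) with subset-of-size A (to (P⇔ A) PA)
  ... | B , B⊆A , ∣B∣≡k =
    ≤-antisym (subst (∣ A ∣ ≤_) ∣B∣≡k (p⊆q⇒∣p∣≤∣q∣ (minimal B B⊆A (from (P⇔ B) (≤-reflexive (sym ∣B∣≡k))))))
              (to (P⇔ A) PA)
  size⇒minimal : ∣ A ∣ ≡ k → Minimal P A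
  size⇒minimal ∣A∣≡k =
    from (P⇔ A) (≤-reflexive (sym ∣A∣≡k)) ,
    λ B B⊆A PB → p⊆q∧∣q∣≤∣p∣⇒q⊆p B⊆A (subst (_≤ ∣ B ∣) (sym ∣A∣≡k) (to (P⇔ B) PB))

no-bounded-ascent : ∀ {A : Set} (f : A → ℕ) b → (∀ x → f x ≤ b) → (∀ x → ∃[ y ] f x < f y) → ¬ A
no-bounded-ascent {A} f b f≤b ascent x = contradiction (climb (suc b)) λ { (y , b<fy) → <⇒≱ b<fy (f≤b y) }
  where
  climb : ∀ t → ∃[ y ] t ≤ f y
  climb zero = x , z≤n
  climb (suc t) with climb t
  ... | y , t≤fy with ascent y
  ...   | z , fy<fz = z , ≤-trans (s≤s t≤fy) fy<fz

module _ (G : Graph n) where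

  adj? : ∀ x y → Dec (Adj G x y)
  adj? x y = adj G x y Bool.≟ true

  Adj-sym : Adj G x y → Adj G y x
  Adj-sym {x} {y} x~y = trans (Graph.sym G y x) x~y

  Adj⇒≢ : Adj G x y → x ≢ y
  Adj⇒≢ {x} x~x refl with trans (sym x~x) (irrefl G x)
  ... | ()

  ¬Adj⇒adj≡false : ¬ Adj G x y → adj G x y ≡ false
  ¬Adj⇒adj≡false {x} {y} x≁y with adj G x y
  ... | true  = contradiction refl x≁y
  ... | false = refl

SoleNeighbourIn : Graph n → Subset n → Fin n → Fin n → Set
SoleNeighbourIn G B x a = a ∈ B × Adj G x a × (∀ u → Adj G x u → u ≢ a → u ∉ B)

Fort : Graph n → Subset n → Set
Fort G B = ∀ x a → x ∉ B → ¬ SoleNeighbourIn G B x a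

Disjoint : Subset n → Subset n → Set
Disjoint F B = ∀ {v} → v ∈ F → v ∉ B

module _ {G : Graph n} where

  fort-avoids-black : ∀ {B F v} → Fort G B → Disjoint F B → Black G F v → v ∉ B
  fort-avoids-black fort F∩B=∅ (initial v∈F) = F∩B=∅ v∈F
  fort-avoids-black fort F∩B=∅ (force {v} {w} black-v v~w others-black) w∈B =
    fort v w (fort-avoids-black fort F∩B=∅ black-v)
      (w∈B , v~w , λ u v~u u≢w → fort-avoids-black fort F∩B=∅ (others-black u v~u u≢w))

  forcing-meets-fort : ∀ {F B} → IsForcing G F → Nonempty B → Fort G B → ¬ Disjoint F B
  forcing-meets-fort (_ , all-black) (b , b∈B) fort F∩B=∅ = fort-avoids-black fort F∩B=∅ (all-black b) b∈B

  force-sole-neighbour : ∀ {B} → x ∉ B → SoleNeighbourIn G B x a → Black G (∁ B) a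
  force-sole-neighbour x∉B (_ , x~a , others∉B) =
    force (initial (x∉p⇒x∈∁p x∉B)) x~a (λ u x~u u≢a → initial (x∉p⇒x∈∁p (others∉B u x~u u≢a)))

  black-trans : ∀ {F F′ v} → (∀ {u} → u ∈ F′ → Black G F u) → Black G F′ v → Black G F v
  black-trans F′-black (initial v∈F′) = F′-black v∈F′
  black-trans F′-black (force black-v v~w others-black) =
    force (black-trans F′-black black-v) v~w (λ u v~u u≢w → black-trans F′-black (others-black u v~u u≢w))

  immune⇔fort : ∀ {I} → IsImmune G I ⇔ (Nonempty I × Fort G I)
  immune⇔fort = mk⇔ immune⇒fort fort⇒immune
    where
    immune⇒fort : ∀ {I} → IsImmune G I → Nonempty I × Fort G I
    immune⇒fort (nonempty , stays-white) =
      nonempty , λ x a x∉I sole@(a∈I , _) → stays-white a (force-sole-neighbour x∉I sole) a∈I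
    fort⇒immune : ∀ {I} → Nonempty I × Fort G I → IsImmune G I
    fort⇒immune (nonempty , fort) = nonempty , λ v → fort-avoids-black fort x∈∁p⇒x∉p

twins-fort : ∀ (G : Graph n) {x y} → x ≢ y → (∀ v → v ≢ x → v ≢ y → adj G x v ≡ adj G y v) →
             Fort G (⁅ x ⁆ ∪ ⁅ y ⁆)
twins-fort G {x} {y} x≢y twins v a v∉P (a∈P , v~a , others∉P) = sole (x∈p∪q⁻ ⁅ x ⁆ ⁅ y ⁆ a∈P)
  where
  x∈P : x ∈ ⁅ x ⁆ ∪ ⁅ y ⁆
  x∈P = x∈p∪q⁺ (inj₁ (x∈⁅x⁆ x))
  y∈P : y ∈ ⁅ x ⁆ ∪ ⁅ y ⁆
  y∈P = x∈p∪q⁺ (inj₂ (x∈⁅x⁆ y))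
  v~x⇔v~y : Adj G v x ⇔ Adj G v y
  v~x⇔v~y = mk⇔ (λ v~x → Adj-sym G (trans (sym same) (Adj-sym G v~x)))
                (λ v~y → Adj-sym G (trans same (Adj-sym G v~y)))
    where
    same : adj G x v ≡ adj G y v
    same = twins v (λ { refl → v∉P x∈P }) (λ { refl → v∉P y∈P })
  sole : ¬ (a ∈ ⁅ x ⁆ ⊎ a ∈ ⁅ y ⁆)
  sole (inj₁ a∈⁅x⁆) with refl ← x∈⁅y⁆⇒x≡y x a∈⁅x⁆ = others∉P y (to v~x⇔v~y v~a) (x≢y ∘ sym) y∈P
  sole (inj₂ a∈⁅y⁆) with refl ← x∈⁅y⁆⇒x≡y y a∈⁅y⁆ = others∉P x (from v~x⇔v~y v~a) x≢y x∈P

module NoFortThreshold (G : Graph n) (m : ℕ) (2≤m : 2 ≤ m)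
  (fort-of-size : ∀ W → ∣ W ∣ ≡ suc m → Fort G W)
  (no-small-fort : ∀ B → Nonempty B → ∣ B ∣ ≤ m → ¬ Fort G B)
  where

  nonNeighbours : Fin n → Subset n
  nonNeighbours x = tabulate λ v → not (adj G x v) ∧ not (does (v ≟ x))

  ∈nonNeighbours⁻ : y ∈ nonNeighbours x → ¬ Adj G x y × y ≢ x
  ∈nonNeighbours⁻ {y} {x} y∈ with adj G x y | y ≟ x | trans (sym (lookup∘tabulate _ y)) ([]=⇒lookup y∈)
  ... | false | no y≢x | _ = (λ ()) , y≢x
  ... | false | yes _  | ()
  ... | true  | _      | ()

  ∈nonNeighbours⁺ : ¬ Adj G x y → y ≢ x → y ∈ nonNeighbours x
  ∈nonNeighbours⁺ {x} {y} x≁y y≢x = lookup⇒[]= y _ (trans (lookup∘tabulate _ y) selected)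
    where
    selected : not (adj G x y) ∧ not (does (y ≟ x)) ≡ true
    selected rewrite ¬Adj⇒adj≡false G x≁y with y ≟ x
    ... | yes y≡x = contradiction y≡x y≢x
    ... | no _    = refl

  x∉nonNeighbours : x ∉ nonNeighbours x
  x∉nonNeighbours x∈ = proj₂ (∈nonNeighbours⁻ x∈) refl

  has-neighbour : ∀ x → ∃[ y ] Adj G x y
  has-neighbour x with any? (adj? G x)
  ... | yes found = found
  ... | no isolated = ⊥-elim (no-small-fort ⁅ x ⁆ (x , x∈⁅x⁆ x) ∣⁅x⁆∣≤m singleton-fort)
    where
    ∣⁅x⁆∣≤m : ∣ ⁅ x ⁆ ∣ ≤ m
    ∣⁅x⁆∣≤m = subst (_≤ m) (sym (∣⁅x⁆∣≡1 x)) (≤-trans (s≤s z≤n) 2≤m)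
    singleton-fort : Fort G ⁅ x ⁆
    singleton-fort v a _ (a∈⁅x⁆ , v~a , _) rewrite x∈⁅y⁆⇒x≡y x a∈⁅x⁆ = isolated (v , Adj-sym G v~a)

  -- Otherwise m non-neighbours of x and one neighbour form an (m + 1)-set that is not a fort.
  ∣nonNeighbours∣<m : ∀ x → ∣ nonNeighbours x ∣ < m
  ∣nonNeighbours∣<m x with m ≤? ∣ nonNeighbours x ∣ | has-neighbour x
  ... | no m≰ | _ = ≰⇒> m≰
  ... | yes m≤ | a , x~a with subset-of-size (nonNeighbours x) m≤
  ...   | Q , Q⊆ , ∣Q∣≡m = ⊥-elim (fort-of-size W ∣W∣≡1+m x a x∉W (a∈W , x~a , others∉W))
    where
    W = Q ∪ ⁅ a ⁆
    a∉Q : a ∉ Q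
    a∉Q a∈Q = proj₁ (∈nonNeighbours⁻ (Q⊆ a∈Q)) x~a
    ∣W∣≡1+m : ∣ W ∣ ≡ suc m
    ∣W∣≡1+m = trans (∣p∪⁅x⁆∣≡1+∣p∣ a∉Q) (cong suc ∣Q∣≡m)
    a∈W : a ∈ W
    a∈W = x∈p∪q⁺ (inj₂ (x∈⁅x⁆ a))
    x∉W : x ∉ W
    x∉W x∈W with x∈p∪q⁻ Q ⁅ a ⁆ x∈W
    ... | inj₁ x∈Q = x∉nonNeighbours (Q⊆ x∈Q)
    ... | inj₂ x∈⁅a⁆ = Adj⇒≢ G x~a (x∈⁅y⁆⇒x≡y a x∈⁅a⁆)
    others∉W : ∀ u → Adj G x u → u ≢ a → u ∉ W
    others∉W u x~u u≢a u∈W with x∈p∪q⁻ Q ⁅ a ⁆ u∈W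
    ... | inj₁ u∈Q = proj₁ (∈nonNeighbours⁻ (Q⊆ u∈Q)) x~u
    ... | inj₂ u∈⁅a⁆ = u≢a (x∈⁅y⁆⇒x≡y a u∈⁅a⁆)

  -- Otherwise every vertex outside nonNeighbours x ∪ ⁅ x ⁆ has two neighbours in it.
  neighbour-missing-nonNeighbours : ∀ x → ∃[ y ] Adj G x y × (∀ z → z ∈ nonNeighbours x → ¬ Adj G y z)
  neighbour-missing-nonNeighbours x
    with any? (λ y → adj? G x y ×-dec ¬? (any? λ z → z ∈? nonNeighbours x ×-dec adj? G y z))
  ... | yes (y , x~y , none) = y , x~y , λ z z∈ y~z → none (z , z∈ , y~z)
  ... | no missing = ⊥-elim (no-small-fort B (x , x∈B) ∣B∣≤m B-fort)
    where
    B = nonNeighbours x ∪ ⁅ x ⁆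
    x∈B : x ∈ B
    x∈B = x∈p∪q⁺ (inj₂ (x∈⁅x⁆ x))
    ∣B∣≤m : ∣ B ∣ ≤ m
    ∣B∣≤m = subst (_≤ m) (sym (∣p∪⁅x⁆∣≡1+∣p∣ x∉nonNeighbours)) (∣nonNeighbours∣<m x)
    x~outside : ∀ {v} → v ∉ B → Adj G x v
    x~outside {v} v∉B with adj? G x v
    ... | yes x~v = x~v
    ... | no x≁v = contradiction (x∈p∪q⁺ (inj₁ (∈nonNeighbours⁺ x≁v λ { refl → v∉B x∈B }))) v∉B
    B-fort : Fort G B
    B-fort v a v∉B (a∈B , v~a , others∉B) with any? (λ z → z ∈? nonNeighbours x ×-dec adj? G v z)
    ... | no none = missing (v , x~outside v∉B , none)
    ... | yes (z , z∈ , v~z) with a ≟ x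
    ...   | yes refl = others∉B z v~z (proj₂ (∈nonNeighbours⁻ z∈)) (x∈p∪q⁺ (inj₁ z∈))
    ...   | no a≢x = others∉B x (Adj-sym G (x~outside v∉B)) (a≢x ∘ sym) x∈B

  distinguishing-vertex : Adj G x y → ∃[ z ] z ≢ x × z ≢ y × adj G x z ≢ adj G y z
  distinguishing-vertex {x} {y} x~y
    with any? (λ z → ¬? (z ≟ x) ×-dec ¬? (z ≟ y) ×-dec ¬? (adj G x z Bool.≟ adj G y z))
  ... | yes found = found
  ... | no none = ⊥-elim (no-small-fort P (x , x∈p∪q⁺ (inj₁ (x∈⁅x⁆ x))) ∣P∣≤m (twins-fort G x≢y twins))
    where
    x≢y = Adj⇒≢ G x~y
    P = ⁅ x ⁆ ∪ ⁅ y ⁆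
    ∣P∣≤m : ∣ P ∣ ≤ m
    ∣P∣≤m = subst (_≤ m) (sym (trans (∣p∪⁅x⁆∣≡1+∣p∣ (x≢y⇒x∉⁅y⁆ (x≢y ∘ sym))) (cong suc (∣⁅x⁆∣≡1 x)))) 2≤m
    twins : ∀ v → v ≢ x → v ≢ y → adj G x v ≡ adj G y v
    twins v v≢x v≢y with adj G x v Bool.≟ adj G y v
    ... | yes same = same
    ... | no differ = contradiction (v , v≢x , v≢y , differ) none

  nonNeighbours-⊂ : ∀ {z} → Adj G x y → (∀ w → w ∈ nonNeighbours x → ¬ Adj G y w) →
                    z ≢ x → z ≢ y → adj G x z ≢ adj G y z → nonNeighbours x ⊂ nonNeighbours y
  nonNeighbours-⊂ {x} {y} {z} x~y y≁R z≢x z≢y differ with adj G x z in x-z | adj G y z in y-z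
  ... | true  | true  = contradiction refl differ
  ... | false | false = contradiction refl differ
  ... | false | true  =
    contradiction y-z (y≁R z (∈nonNeighbours⁺ (λ x~z → contradiction (trans (sym x-z) x~z) λ ()) z≢x))
  ... | true  | false = R⊆R , z , ∈nonNeighbours⁺ (λ y~z → contradiction (trans (sym y-z) y~z) λ ()) z≢y ,
                        λ z∈ → proj₁ (∈nonNeighbours⁻ z∈) x-z
    where
    R⊆R : nonNeighbours x ⊆ nonNeighbours y
    R⊆R {w} w∈ = ∈nonNeighbours⁺ (y≁R w w∈) λ { refl → proj₁ (∈nonNeighbours⁻ w∈) x~y }

  nonNeighbours-grow : ∀ x → ∃[ y ] ∣ nonNeighbours x ∣ < ∣ nonNeighbours y ∣
  nonNeighbours-grow x with neighbour-missing-nonNeighbours x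
  ... | y , x~y , y≁R with distinguishing-vertex x~y
  ...   | z , z≢x , z≢y , differ = y , p⊂q⇒∣p∣<∣q∣ (nonNeighbours-⊂ x~y y≁R z≢x z≢y differ)

  no-vertex : ¬ Fin n
  no-vertex = no-bounded-ascent (∣_∣ ∘ nonNeighbours) n (∣p∣≤n ∘ nonNeighbours) nonNeighbours-grow

uniform-immune-k≥3 : ∀ (G : Graph n) {k} → 3 ≤ k → k ≤ n → EqualsUniform (IsImmune G) k → ¬ Fin n
uniform-immune-k≥3 G {suc m} (s≤s 2≤m) 1+m≤n uniform =
  NoFortThreshold.no-vertex G m 2≤m fort-of-size no-small-fort
  where
  fort-of-size : ∀ W → ∣ W ∣ ≡ suc m → Fort G W
  fort-of-size W ∣W∣≡1+m = proj₂ (to immune⇔fort (proj₁ (from (uniform W) ∣W∣≡1+m)))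
  no-small-fort : ∀ B → Nonempty B → ∣ B ∣ ≤ m → ¬ Fort G B
  no-small-fort B nonempty ∣B∣≤m fort with superset-of-size B (m≤n⇒m≤1+n ∣B∣≤m) 1+m≤n
  ... | A , B⊆A , ∣A∣≡1+m = <⇒≱ (s≤s ∣B∣≤m) (subst (_≤ ∣ B ∣) ∣A∣≡1+m (p⊆q⇒∣p∣≤∣q∣ A⊆B))
    where
    A⊆B : A ⊆ B
    A⊆B = proj₂ (from (uniform A) ∣A∣≡1+m) B B⊆A (from immune⇔fort (nonempty , fort))

uniform-forcing-k+2≤n : ∀ (G : Graph n) {k} → 1 ≤ k → 2 + k ≤ n → EqualsUniform (IsForcing G) k → ¬ Fin n
uniform-forcing-k+2≤n {n} G {suc k′} _ 2+k≤n uniform =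
  NoFortThreshold.no-vertex G (n ∸ k) (m+n≤o⇒m≤o∸n 2 2+k≤n) fort-of-size no-small-fort
  where
  k = suc k′
  k≤n : k ≤ n
  k≤n = ≤-trans (m≤n+m k 2) 2+k≤n
  no-small-fort : ∀ B → Nonempty B → ∣ B ∣ ≤ n ∸ k → ¬ Fort G B
  no-small-fort B nonempty ∣B∣≤n∸k fort with subset-of-size (∁ B) k≤∣∁B∣
    where
    k≤∣∁B∣ : k ≤ ∣ ∁ B ∣
    k≤∣∁B∣ = subst₂ _≤_ (m∸[m∸n]≡n k≤n) (sym (∣∁p∣≡n∸∣p∣ B)) (∸-monoʳ-≤ n ∣B∣≤n∸k)
  ... | F , F⊆∁B , ∣F∣≡k =
    forcing-meets-fort (proj₁ (from (uniform F) ∣F∣≡k)) nonempty fort (x∈∁p⇒x∉p ∘ F⊆∁B)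
  -- If a is the sole neighbour in W of some x ∉ W, then ∁ W forces a, so the k-set ∁ W ∪ ⁅ a ⁆
  -- is not a minimal forcing set.
  fort-of-size : ∀ W → ∣ W ∣ ≡ suc (n ∸ k) → Fort G W
  fort-of-size W ∣W∣≡ x a x∉W sole@(a∈W , _ , _) =
    x∈p⇒x∉∁p a∈W (proj₂ minimal (∁ W) (p⊆p∪q ⁅ a ⁆) ∁W-forcing (x∈p∪q⁺ (inj₂ (x∈⁅x⁆ a))))
    where
    F = ∁ W ∪ ⁅ a ⁆
    ∣F∣≡k : ∣ F ∣ ≡ k
    ∣F∣≡k = begin
      ∣ F ∣                          ≡⟨ ∣p∪⁅x⁆∣≡1+∣p∣ (x∈p⇒x∉∁p a∈W) ⟩
      suc ∣ ∁ W ∣                    ≡⟨ cong suc (∣∁p∣≡n∸∣p∣ W) ⟩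
      suc (n ∸ ∣ W ∣)                ≡⟨ cong (λ w → suc (n ∸ w)) ∣W∣≡ ⟩
      suc (n ∸ suc (n ∸ k))          ≡⟨ cong suc (sym (pred[m∸n]≡m∸[1+n] n (n ∸ k))) ⟩
      suc (pred (n ∸ (n ∸ k))) ≡⟨ cong (λ w → suc (pred w)) (m∸[m∸n]≡n k≤n) ⟩
      k                              ∎
      where open ≡-Reasoning
    minimal : Minimal (IsForcing G) F
    minimal = from (uniform F) ∣F∣≡k
    F-black : ∀ {u} → u ∈ F → Black G (∁ W) u
    F-black {u} u∈F with x∈p∪q⁻ (∁ W) ⁅ a ⁆ u∈F
    ... | inj₁ u∈∁W = initial u∈∁W
    ... | inj₂ u∈⁅a⁆ with refl ← x∈⁅y⁆⇒x≡y a u∈⁅a⁆ = force-sole-neighbour x∉W sole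
    ∁W-forcing : IsForcing G (∁ W)
    ∁W-forcing = (x , x∉p⇒x∈∁p x∉W) , λ v → black-trans F-black (proj₂ (proj₁ minimal) v)

other-vertex : 2 ≤ n → ∀ (x : Fin n) → ∃[ y ] y ≢ x
other-vertex {n} 2≤n x with 2≤∣p∣⇒∃≢ {p = ⊤} (subst (2 ≤_) (sym (∣⊤∣≡n n)) 2≤n) x
... | y , _ , y≢x = y , y≢x

emptyGraph : Graph n
emptyGraph = record { adj = λ _ _ → false ; sym = λ _ _ → refl ; irrefl = λ _ → refl }

emptyGraph-fort : ∀ B → Fort (emptyGraph {n}) B
emptyGraph-fort B x a x∉B (_ , () , _)

black-in-emptyGraph : ∀ {F v} → Black (emptyGraph {n}) F v → v ∈ F
black-in-emptyGraph (initial v∈F) = v∈F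
black-in-emptyGraph (force _ () _)

emptyGraph-immune : ∀ A → IsImmune (emptyGraph {n}) A ⇔ 1 ≤ ∣ A ∣
emptyGraph-immune A =
  mk⇔ (Nonempty⇒1≤∣p∣ ∘ proj₁) (λ 1≤∣A∣ → from immune⇔fort (1≤∣p∣⇒Nonempty 1≤∣A∣ , emptyGraph-fort A))

emptyGraph-forcing : 1 ≤ n → ∀ A → IsForcing (emptyGraph {n}) A ⇔ n ≤ ∣ A ∣
emptyGraph-forcing {n} 1≤n A = mk⇔ forcing⇒full full⇒forcing
  where
  forcing⇒full : IsForcing emptyGraph A → n ≤ ∣ A ∣
  forcing⇒full (_ , all-black) =
    subst (_≤ ∣ A ∣) (∣⊤∣≡n n) (p⊆q⇒∣p∣≤∣q∣ {p = ⊤} λ {v} _ → black-in-emptyGraph (all-black v))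
  full⇒forcing : n ≤ ∣ A ∣ → IsForcing emptyGraph A
  full⇒forcing n≤∣A∣ =
    1≤∣p∣⇒Nonempty (≤-trans 1≤n n≤∣A∣) ,
    λ v → initial (subst (v ∈_) (sym (∣p∣≡n⇒p≡⊤ (≤-antisym (∣p∣≤n A) n≤∣A∣))) ∈⊤)

completeGraph : Graph n
completeGraph = record { adj = λ i j → not (does (i ≟ j)) ; sym = symmetric ; irrefl = irreflexive }
  where
  symmetric : ∀ i j → not (does (i ≟ j)) ≡ not (does (j ≟ i))
  symmetric i j with i ≟ j | j ≟ i
  ... | yes _   | yes _   = refl
  ... | no _    | no _    = refl
  ... | yes i≡j | no j≢i = contradiction (sym i≡j) j≢i
  ... | no i≢j  | yes j≡i = contradiction (sym j≡i) i≢j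
  irreflexive : ∀ i → not (does (i ≟ i)) ≡ false
  irreflexive i with i ≟ i
  ... | yes _ = refl
  ... | no i≢i = contradiction refl i≢i

≢⇒Adj-complete : x ≢ y → Adj completeGraph x y
≢⇒Adj-complete {x = x} {y} x≢y with x ≟ y
... | yes x≡y = contradiction x≡y x≢y
... | no _    = refl

completeGraph-fort : ∀ {B : Subset n} → 2 ≤ ∣ B ∣ → Fort completeGraph B
completeGraph-fort 2≤∣B∣ x a x∉B (a∈B , _ , others∉B) with 2≤∣p∣⇒∃≢ 2≤∣B∣ a
... | b , b∈B , b≢a = others∉B b (≢⇒Adj-complete {x = x} λ { refl → x∉B b∈B }) b≢a b∈B

completeGraph-fort⇒2≤∣B∣ : ∀ {B : Subset n} → 2 ≤ n → Nonempty B → Fort completeGraph B → 2 ≤ ∣ B ∣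
completeGraph-fort⇒2≤∣B∣ {B = B} 2≤n (i , i∈B) fort with 2 ≤? ∣ B ∣
... | yes 2≤∣B∣ = 2≤∣B∣
... | no 2≰∣B∣ with other-vertex 2≤n i
...   | x , x≢i =
  contradiction (i∈B , ≢⇒Adj-complete x≢i , λ u _ u≢i u∈B → u≢i (only-i u∈B)) (fort x i (x≢i ∘ only-i))
  where
  only-i : ∀ {u} → u ∈ B → u ≡ i
  only-i {u} u∈B with u ≟ i
  ... | yes u≡i = u≡i
  ... | no u≢i = contradiction (x∈p∧y∈p∧x≢y⇒2≤∣p∣ u∈B i∈B u≢i) 2≰∣B∣

completeGraph-immune : 2 ≤ n → ∀ A → IsImmune (completeGraph {n}) A ⇔ 2 ≤ ∣ A ∣
completeGraph-immune 2≤n A = mk⇔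
  (λ immune → let nonempty , fort = to immune⇔fort immune in completeGraph-fort⇒2≤∣B∣ 2≤n nonempty fort)
  (λ 2≤∣A∣ → from immune⇔fort (1≤∣p∣⇒Nonempty (≤-trans (s≤s z≤n) 2≤∣A∣) , completeGraph-fort 2≤∣A∣))

completeGraph-forcing : 2 ≤ n → ∀ A → IsForcing (completeGraph {n}) A ⇔ n ∸ 1 ≤ ∣ A ∣
completeGraph-forcing {n} 2≤n A = mk⇔ forcing⇒large large⇒forcing
  where
  1≤n : 1 ≤ n
  1≤n = ≤-trans (s≤s z≤n) 2≤n
  forcing⇒large : IsForcing completeGraph A → n ∸ 1 ≤ ∣ A ∣
  forcing⇒large forcing with n ∸ 1 ≤? ∣ A ∣
  ... | yes large = large
  ... | no small = ⊥-elim (forcing-meets-fort forcing (1≤∣p∣⇒Nonempty (≤-trans (s≤s z≤n) 2≤∣∁A∣))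
                                               (completeGraph-fort 2≤∣∁A∣) x∈p⇒x∉∁p)
    where
    2+∣A∣≤n : 2 + ∣ A ∣ ≤ n
    2+∣A∣≤n = subst (_≤ n) (+-comm (suc ∣ A ∣) 1) (m≤o∸n⇒m+n≤o (suc ∣ A ∣) 1≤n (≰⇒> small))
    2≤∣∁A∣ : 2 ≤ ∣ ∁ A ∣
    2≤∣∁A∣ = subst (2 ≤_) (sym (∣∁p∣≡n∸∣p∣ A)) (m+n≤o⇒m≤o∸n 2 2+∣A∣≤n)
  large⇒forcing : n ∸ 1 ≤ ∣ A ∣ → IsForcing completeGraph A
  large⇒forcing large = 1≤∣p∣⇒Nonempty (≤-trans (m+n≤o⇒m≤o∸n 1 2≤n) large) , black
    where
    ∣∁A∣≤1 : ∣ ∁ A ∣ ≤ 1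
    ∣∁A∣≤1 = subst₂ _≤_ (sym (∣∁p∣≡n∸∣p∣ A)) (m∸[m∸n]≡n 1≤n) (∸-monoʳ-≤ n large)
    others-in : ∀ {u v} → v ∉ A → u ≢ v → u ∈ A
    others-in {u} v∉A u≢v with u ∈? A
    ... | yes u∈A = u∈A
    ... | no u∉A = contradiction (x∈p∧y∈p∧x≢y⇒2≤∣p∣ (x∉p⇒x∈∁p u∉A) (x∉p⇒x∈∁p v∉A) u≢v) (<⇒≱ (s≤s ∣∁A∣≤1))
    black : ∀ v → Black completeGraph A v
    black v with v ∈? A | other-vertex 2≤n v
    ... | yes v∈A | _ = initial v∈A
    ... | no v∉A | x , x≢v =
      force (initial (others-in v∉A x≢v)) (≢⇒Adj-complete x≢v) (λ u _ u≢v → initial (others-in v∉A u≢v))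

1≤k≤2⇒k≡1⊎k≡2 : ∀ {k} → 1 ≤ k → k ≤ 2 → k ≡ 1 ⊎ k ≡ 2
1≤k≤2⇒k≡1⊎k≡2 {1} _ _ = inj₁ refl
1≤k≤2⇒k≡1⊎k≡2 {2} _ _ = inj₂ refl
1≤k≤2⇒k≡1⊎k≡2 {suc (suc (suc _))} _ (s≤s (s≤s ()))

k≤n≤1+k⇒k≡n∸1⊎k≡n : ∀ {k n} → k ≤ n → n ≤ suc k → k ≡ n ∸ 1 ⊎ k ≡ n
k≤n≤1+k⇒k≡n∸1⊎k≡n {k} {n} k≤n n≤1+k with k Data.Nat.≟ n
... | yes k≡n = inj₂ k≡n
... | no k≢n = inj₁ (cong (_∸ 1) (≤-antisym (≤∧≢⇒< k≤n k≢n) n≤1+k))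

theorem3 : ∀ (n k : ℕ) → 1 ≤ k → k ≤ n →
    (GraphImmuneUniform n k ⇔ (k ≡ 1 ⊎ k ≡ 2)) ×
    (GraphForcingUniform n k ⇔ (k ≡ n ∸ 1 ⊎ k ≡ n))
theorem3 n k 1≤k k≤n = mk⇔ immune⇒ immune⇐ , mk⇔ forcing⇒ forcing⇐
  where
  vertex : Fin n
  vertex = fromℕ< (≤-trans 1≤k k≤n)
  immune⇒ : GraphImmuneUniform n k → k ≡ 1 ⊎ k ≡ 2
  immune⇒ (G , uniform) =
    1≤k≤2⇒k≡1⊎k≡2 1≤k (≮⇒≥ λ 3≤k → uniform-immune-k≥3 G 3≤k k≤n uniform vertex)
  immune⇐ : k ≡ 1 ⊎ k ≡ 2 → GraphImmuneUniform n k
  immune⇐ (inj₁ refl) = emptyGraph , threshold⇒uniform 1 emptyGraph-immune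
  immune⇐ (inj₂ refl) = completeGraph , threshold⇒uniform 2 (completeGraph-immune k≤n)
  forcing⇒ : GraphForcingUniform n k → k ≡ n ∸ 1 ⊎ k ≡ n
  forcing⇒ (G , uniform) =
    k≤n≤1+k⇒k≡n∸1⊎k≡n k≤n (≮⇒≥ λ 2+k≤n → uniform-forcing-k+2≤n G 1≤k 2+k≤n uniform vertex)
  forcing⇐ : k ≡ n ∸ 1 ⊎ k ≡ n → GraphForcingUniform n k
  forcing⇐ (inj₁ refl) =
    completeGraph , threshold⇒uniform (n ∸ 1) (completeGraph-forcing (m∸n≢0⇒n<m (≢-sym (<⇒≢ 1≤k))))
  forcing⇐ (inj₂ refl) = emptyGraph , threshold⇒uniform n (emptyGraph-forcing 1≤k)
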